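{- Let $G$ be a locally linear graph and let $G^*$ be its triangle graph. Then any two nonadjacent vertices of $G^*$ have at most three common neighbours in $G^*$.
   Context: All graphs are finite, simple and undirected. A graph $G$ is locally linear if it has no isolated vertices and for every vertex $v$ the subgraph induced on its neighbourhood $N(v)=\{w\in V(G): w\sim v, w\neq v\}$ is $1$-regular; equivalently, every edge of $G$ lies in exactly one triangle (so two distinct triangles of $G$ share at most one vertex). The triangle graph $G^*$ of a locally linear graph $G$ is the graph whose vertex set is the set of triangles of $G$, two distinct triangles being adjacent in $G^*$ if and only if they share a common vertex in $G$. -}

module Defs where

open import Data.Nat using (ℕ)
open import Data.Fin using (Fin; _<_)
open import Data.Bool using (Bool; true; false)
open import Data.Product using (Σ; ∃; ∃-syntax; _×_; _,_)
open import Data.Sum using (_⊎_)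
open import Data.List using (List; length)
open import Data.List.Relation.Unary.All using (All)
open import Data.List.Relation.Unary.Unique.Propositional using (Unique)
open import Relation.Nullary using (¬_)
open import Relation.Binary.PropositionalEquality using (_≡_; _≢_)

record Graph (n : ℕ) : Set where
  field
    adj       : Fin n → Fin n → Bool
    adj-sym   : ∀ u v → adj u v ≡ adj v u
    adj-irrefl : ∀ v → adj v v ≡ false
open Graph public

module _ {n : ℕ} (G : Graph n) where

  Adj : Fin n → Fin n → Set
  Adj u v = adj G u v ≡ true

  InNbhd : Fin n → Fin n → Set
  InNbhd v w = Adj v w

  NbhdOneRegular : Fin n → Set
  NbhdOneRegular v =
    ∀ w → InNbhd v w →
      Σ (Fin n) λ u → (InNbhd v u × Adj w u) ×
        (∀ u′ → InNbhd v u′ → Adj w u′ → u′ ≡ u)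

  LocallyLinear : Set
  LocallyLinear = (∀ v → ∃[ w ] Adj v w) × (∀ v → NbhdOneRegular v)

  -- a triangle of G, i.e. a 3-element vertex set {a,b,c} of pairwise
  -- adjacent vertices, represented canonically with a < b < c
  record Triangle : Set where
    constructor tri
    field
      a b c : Fin n
      a<b   : a < b
      b<c   : b < c
      ab    : Adj a b
      bc    : Adj b c
      ac    : Adj a c

  _∈T_ : Fin n → Triangle → Set
  x ∈T t = (x ≡ Triangle.a t) ⊎ (x ≡ Triangle.b t) ⊎ (x ≡ Triangle.c t)

  AdjT : Triangle → Triangle → Set
  AdjT s t = s ≢ t × ∃[ x ] (x ∈T s × x ∈T t)

{-# OPTIONS --safe #-}
-- Two nonadjacent triangles s and t of G are vertex-disjoint, and a common
-- neighbour r of theirs meets s in a vertex x and t in a vertex y. As x lies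
-- outside t, it is adjacent to at most one vertex of t: two neighbours y, y′
-- in t would make x a common neighbour of the edge yy′, but local linearity
-- says the third vertex of t is the only one. So y, and with it r (the unique
-- triangle on the edge xy), is determined by x, and r ↦ x injects the common
-- neighbours into the three vertices of s.
module Submission where

open import Defs
open import Data.Nat using (ℕ; _≤_)
open import Data.List using (List; length)
open import Data.List.Relation.Unary.All using (All)
open import Data.List.Relation.Unary.Unique.Propositional using (Unique)
open import Data.Product using (_×_)
open import Relation.Nullary using (¬_)
open import Relation.Binary.PropositionalEquality using (_≢_)

open import Axiom.UniquenessOfIdentityProofs using (UIP; module Decidable⇒UIP)
open import Data.Bool using (Bool)
import Data.Bool.Properties as Bool
open import Data.Fin as Fin using (Fin; zero; suc)
import Data.Fin.Properties as Fin
open import Data.List using (_∷_; lookup)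
open import Data.List.Relation.Unary.All using (_∷_)
open import Data.List.Relation.Unary.AllPairs using (_∷_)
import Data.Nat.Properties as ℕ
open import Data.Product using (∃-syntax; _,_; proj₂)
open import Data.Sum using (inj₁; inj₂)
open import Function.Definitions using (Injective)
open import Relation.Nullary using (yes; no; contradiction)
open import Relation.Binary.PropositionalEquality using (_≡_; refl; sym; trans; cong; subst; ≢-sym)

module _ {A : Set} where

  All-lookup : ∀ {P : A → Set} {xs : List A} → All P xs →
               (i : Fin (length xs)) → P (lookup xs i)
  All-lookup (px ∷ _)   zero    = px
  All-lookup (_  ∷ pxs) (suc i) = All-lookup pxs i

  Unique⇒lookup-injective : ∀ {xs : List A} → Unique xs → Injective _≡_ _≡_ (lookup xs)
  Unique⇒lookup-injective (_   ∷ _) {zero}  {zero}  _  = refl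
  Unique⇒lookup-injective (x≢ ∷ _) {zero}  {suc j} eq = contradiction eq (All-lookup x≢ j)
  Unique⇒lookup-injective (x≢ ∷ _) {suc i} {zero}  eq = contradiction (sym eq) (All-lookup x≢ i)
  Unique⇒lookup-injective (_   ∷ u) {suc i} {suc j} eq = cong suc (Unique⇒lookup-injective u eq)

  length≤-by-injective-labelling :
    ∀ {P : A → Set} {k} {xs : List A} → Unique xs → (pxs : All P xs) →
    (label : ∀ {x} → P x → Fin k) →
    (∀ {x y} (px : P x) (py : P y) → label px ≡ label py → x ≡ y) →
    length xs ≤ k
  length≤-by-injective-labelling u pxs label label-injective =
    Fin.injective⇒≤ λ eq →
      Unique⇒lookup-injective u (label-injective (All-lookup pxs _) (All-lookup pxs _) eq)

Bool-UIP : UIP Bool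
Bool-UIP = Decidable⇒UIP.≡-irrelevant Bool._≟_

module _ {n : ℕ} (G : Graph n) where

  open Triangle

  _∼_ : Fin n → Fin n → Set
  _∼_ = Adj G

  _∈ᵀ_ : Fin n → Triangle G → Set
  _∈ᵀ_ = _∈T_ G

  ∼-sym : ∀ {x y} → x ∼ y → y ∼ x
  ∼-sym {x} {y} x∼y = trans (adj-sym G y x) x∼y

  a≢b : (r : Triangle G) → a r ≢ b r
  a≢b r = Fin.<⇒≢ (a<b r)

  b≢c : (r : Triangle G) → b r ≢ c r
  b≢c r = Fin.<⇒≢ (b<c r)

  a≢c : (r : Triangle G) → a r ≢ c r
  a≢c r = Fin.<⇒≢ (Fin.<-trans (a<b r) (b<c r))

  ∈ᵀ⇒∼ : ∀ {x y} (r : Triangle G) → x ∈ᵀ r → y ∈ᵀ r → x ≢ y → x ∼ y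
  ∈ᵀ⇒∼ r (inj₁ refl)        (inj₁ refl)        x≢y = contradiction refl x≢y
  ∈ᵀ⇒∼ r (inj₁ refl)        (inj₂ (inj₁ refl)) _   = ab r
  ∈ᵀ⇒∼ r (inj₁ refl)        (inj₂ (inj₂ refl)) _   = ac r
  ∈ᵀ⇒∼ r (inj₂ (inj₁ refl)) (inj₁ refl)        _   = ∼-sym (ab r)
  ∈ᵀ⇒∼ r (inj₂ (inj₁ refl)) (inj₂ (inj₁ refl)) x≢y = contradiction refl x≢y
  ∈ᵀ⇒∼ r (inj₂ (inj₁ refl)) (inj₂ (inj₂ refl)) _   = bc r
  ∈ᵀ⇒∼ r (inj₂ (inj₂ refl)) (inj₁ refl)        _   = ∼-sym (ac r)
  ∈ᵀ⇒∼ r (inj₂ (inj₂ refl)) (inj₂ (inj₁ refl)) _   = ∼-sym (bc r)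
  ∈ᵀ⇒∼ r (inj₂ (inj₂ refl)) (inj₂ (inj₂ refl)) x≢y = contradiction refl x≢y

  third-vertex : ∀ {x y} (r : Triangle G) → x ∈ᵀ r → y ∈ᵀ r → x ≢ y →
                 ∃[ z ] z ∈ᵀ r × x ≢ z × y ≢ z
  third-vertex r (inj₁ refl)        (inj₁ refl)        x≢y = contradiction refl x≢y
  third-vertex r (inj₁ refl)        (inj₂ (inj₁ refl)) _   = c r , inj₂ (inj₂ refl) , a≢c r , b≢c r
  third-vertex r (inj₁ refl)        (inj₂ (inj₂ refl)) _   = b r , inj₂ (inj₁ refl) , a≢b r , ≢-sym (b≢c r)
  third-vertex r (inj₂ (inj₁ refl)) (inj₁ refl)        _   = c r , inj₂ (inj₂ refl) , b≢c r , a≢c r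
  third-vertex r (inj₂ (inj₁ refl)) (inj₂ (inj₁ refl)) x≢y = contradiction refl x≢y
  third-vertex r (inj₂ (inj₁ refl)) (inj₂ (inj₂ refl)) _   = a r , inj₁ refl , ≢-sym (a≢b r) , ≢-sym (a≢c r)
  third-vertex r (inj₂ (inj₂ refl)) (inj₁ refl)        _   = b r , inj₂ (inj₁ refl) , ≢-sym (b≢c r) , a≢b r
  third-vertex r (inj₂ (inj₂ refl)) (inj₂ (inj₁ refl)) _   = a r , inj₁ refl , ≢-sym (a≢c r) , ≢-sym (a≢b r)
  third-vertex r (inj₂ (inj₂ refl)) (inj₂ (inj₂ refl)) x≢y = contradiction refl x≢y

  ∈ᵀ∧∉ᵀ⇒≢ : ∀ {x y} (t : Triangle G) → y ∈ᵀ t → ¬ x ∈ᵀ t → y ≢ x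
  ∈ᵀ∧∉ᵀ⇒≢ t y∈t x∉t refl = x∉t y∈t

  Triangle-≡ : ∀ {r r′ : Triangle G} → a r ≡ a r′ → b r ≡ b r′ → c r ≡ c r′ → r ≡ r′
  Triangle-≡ {tri _ _ _ a<b b<c ab bc ac} {tri _ _ _ a<b′ b<c′ ab′ bc′ ac′} refl refl refl
    rewrite Fin.<-irrelevant a<b a<b′ | Fin.<-irrelevant b<c b<c′
          | Bool-UIP ab ab′ | Bool-UIP bc bc′ | Bool-UIP ac ac′ = refl

  a-minimal : ∀ {v} (r : Triangle G) → v ∈ᵀ r → a r Fin.≤ v
  a-minimal r (inj₁ refl)        = Fin.≤-refl
  a-minimal r (inj₂ (inj₁ refl)) = ℕ.<⇒≤ (a<b r)
  a-minimal r (inj₂ (inj₂ refl)) = ℕ.<⇒≤ (Fin.<-trans (a<b r) (b<c r))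

  c-maximal : ∀ {v} (r : Triangle G) → v ∈ᵀ r → v Fin.≤ c r
  c-maximal r (inj₁ refl)        = ℕ.<⇒≤ (Fin.<-trans (a<b r) (b<c r))
  c-maximal r (inj₂ (inj₁ refl)) = ℕ.<⇒≤ (b<c r)
  c-maximal r (inj₂ (inj₂ refl)) = Fin.≤-refl

  same-vertices⇒≡ : (r r′ : Triangle G) → (∀ v → v ∈ᵀ r → v ∈ᵀ r′) → (∀ v → v ∈ᵀ r′ → v ∈ᵀ r) → r ≡ r′
  same-vertices⇒≡ r r′ r⊆r′ r′⊆r = Triangle-≡ a≡a′ b≡b′ c≡c′
    where
    a≡a′ : a r ≡ a r′
    a≡a′ = Fin.≤-antisym (a-minimal r (r′⊆r _ (inj₁ refl))) (a-minimal r′ (r⊆r′ _ (inj₁ refl)))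
    c≡c′ : c r ≡ c r′
    c≡c′ = Fin.≤-antisym (c-maximal r′ (r⊆r′ _ (inj₂ (inj₂ refl)))) (c-maximal r (r′⊆r _ (inj₂ (inj₂ refl))))
    b≡b′ : b r ≡ b r′
    b≡b′ with r⊆r′ _ (inj₂ (inj₁ refl))
    ... | inj₁ b≡a′        = contradiction (trans a≡a′ (sym b≡a′)) (a≢b r)
    ... | inj₂ (inj₁ b≡b′) = b≡b′
    ... | inj₂ (inj₂ b≡c′) = contradiction (trans b≡c′ (sym c≡c′)) (b≢c r)

  position : ∀ {x} (s : Triangle G) → x ∈ᵀ s → Fin 3
  position s (inj₁ _)        = zero
  position s (inj₂ (inj₁ _)) = suc zero
  position s (inj₂ (inj₂ _)) = suc (suc zero)

  position-injective : ∀ {x x′} (s : Triangle G) (p : x ∈ᵀ s) (p′ : x′ ∈ᵀ s) →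
                       position s p ≡ position s p′ → x ≡ x′
  position-injective s (inj₁ refl)        (inj₁ refl)        _ = refl
  position-injective s (inj₂ (inj₁ refl)) (inj₂ (inj₁ refl)) _ = refl
  position-injective s (inj₂ (inj₂ refl)) (inj₂ (inj₂ refl)) _ = refl
  position-injective s (inj₁ _)           (inj₂ (inj₁ _))    ()
  position-injective s (inj₁ _)           (inj₂ (inj₂ _))    ()
  position-injective s (inj₂ (inj₁ _))    (inj₁ _)           ()
  position-injective s (inj₂ (inj₁ _))    (inj₂ (inj₂ _))    ()
  position-injective s (inj₂ (inj₂ _))    (inj₁ _)           ()
  position-injective s (inj₂ (inj₂ _))    (inj₂ (inj₁ _))    ()

  module _ (locally-linear : LocallyLinear G) where

    common-neighbour-unique : ∀ {x y v w} → x ∼ y → x ∼ v → y ∼ v → x ∼ w → y ∼ w → v ≡ w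
    common-neighbour-unique {x} {y} {v} {w} x∼y x∼v y∼v x∼w y∼w
      with _ , _ , unique ← proj₂ locally-linear x y x∼y
      = trans (unique v x∼v y∼v) (sym (unique w x∼w y∼w))

    ∈ᵀ-by-two-neighbours : ∀ {y y′ v} (t : Triangle G) → y ∈ᵀ t → y′ ∈ᵀ t → y ≢ y′ →
                           y ∼ v → y′ ∼ v → v ∈ᵀ t
    ∈ᵀ-by-two-neighbours t y∈t y′∈t y≢y′ y∼v y′∼v
      with z , z∈t , y≢z , y′≢z ← third-vertex t y∈t y′∈t y≢y′
      = subst (_∈ᵀ t)
          (common-neighbour-unique (∈ᵀ⇒∼ t y∈t y′∈t y≢y′)
            (∈ᵀ⇒∼ t y∈t z∈t y≢z) (∈ᵀ⇒∼ t y′∈t z∈t y′≢z) y∼v y′∼v)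
          z∈t

    shared-edge⇒⊆ : ∀ {x y} (r r′ : Triangle G) → x ≢ y → x ∈ᵀ r → y ∈ᵀ r → x ∈ᵀ r′ → y ∈ᵀ r′ →
                    ∀ v → v ∈ᵀ r → v ∈ᵀ r′
    shared-edge⇒⊆ {x} {y} r r′ x≢y x∈r y∈r x∈r′ y∈r′ v v∈r with v Fin.≟ x | v Fin.≟ y
    ... | yes refl | _        = x∈r′
    ... | no _     | yes refl = y∈r′
    ... | no v≢x   | no v≢y   =
      ∈ᵀ-by-two-neighbours r′ x∈r′ y∈r′ x≢y
        (∈ᵀ⇒∼ r x∈r v∈r (≢-sym v≢x)) (∈ᵀ⇒∼ r y∈r v∈r (≢-sym v≢y))

    shared-edge⇒≡ : ∀ {x y} (r r′ : Triangle G) → x ≢ y → x ∈ᵀ r → y ∈ᵀ r → x ∈ᵀ r′ → y ∈ᵀ r′ → r ≡ r′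
    shared-edge⇒≡ r r′ x≢y x∈r y∈r x∈r′ y∈r′ =
      same-vertices⇒≡ r r′ (shared-edge⇒⊆ r r′ x≢y x∈r y∈r x∈r′ y∈r′)
                           (shared-edge⇒⊆ r′ r x≢y x∈r′ y∈r′ x∈r y∈r)

    ∉ᵀ⇒at-most-one-neighbour : ∀ {v y y′} (t : Triangle G) → ¬ v ∈ᵀ t → y ∈ᵀ t → y′ ∈ᵀ t →
                               y ∼ v → y′ ∼ v → y ≡ y′
    ∉ᵀ⇒at-most-one-neighbour {y = y} {y′} t v∉t y∈t y′∈t y∼v y′∼v with y Fin.≟ y′
    ... | yes y≡y′ = y≡y′
    ... | no y≢y′  = contradiction (∈ᵀ-by-two-neighbours t y∈t y′∈t y≢y′ y∼v y′∼v) v∉t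

    meeting-outside-vertex⇒≡ : ∀ {x y y′} (t r r′ : Triangle G) → ¬ x ∈ᵀ t → x ∈ᵀ r → x ∈ᵀ r′ →
                               y ∈ᵀ t → y ∈ᵀ r → y′ ∈ᵀ t → y′ ∈ᵀ r′ → r ≡ r′
    meeting-outside-vertex⇒≡ t r r′ x∉t x∈r x∈r′ y∈t y∈r y′∈t y′∈r′
      with refl ← ∉ᵀ⇒at-most-one-neighbour t x∉t y∈t y′∈t
                    (∈ᵀ⇒∼ r y∈r x∈r (∈ᵀ∧∉ᵀ⇒≢ t y∈t x∉t)) (∈ᵀ⇒∼ r′ y′∈r′ x∈r′ (∈ᵀ∧∉ᵀ⇒≢ t y′∈t x∉t))
      = shared-edge⇒≡ r r′ (≢-sym (∈ᵀ∧∉ᵀ⇒≢ t y∈t x∉t)) x∈r y∈r x∈r′ y′∈r′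

proposition3 : {n : ℕ} (G : Graph n) → LocallyLinear G →
    (s t : Triangle G) → s ≢ t → ¬ AdjT G s t →
    (cs : List (Triangle G)) → Unique cs →
    All (λ r → AdjT G s r × AdjT G t r) cs →
    length cs ≤ 3
proposition3 G locally-linear s t s≢t s≁t cs cs-unique cs-common =
  length≤-by-injective-labelling cs-unique cs-common label label-injective
  where
  CommonNeighbour : Triangle G → Set
  CommonNeighbour r = AdjT G s r × AdjT G t r

  label : ∀ {r} → CommonNeighbour r → Fin 3
  label ((_ , _ , x∈s , _) , _) = position G s x∈s

  label-injective : ∀ {r r′} (p : CommonNeighbour r) (p′ : CommonNeighbour r′) → label p ≡ label p′ → r ≡ r′
  label-injective {r} {r′} ((_ , _ , x∈s , x∈r) , (_ , _ , y∈t , y∈r))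
                           ((_ , _ , x′∈s , x′∈r′) , (_ , _ , y′∈t , y′∈r′)) eq
    with refl ← position-injective G s x∈s x′∈s eq
    = meeting-outside-vertex⇒≡ G locally-linear t r r′ (λ x∈t → s≁t (s≢t , _ , x∈s , x∈t))
        x∈r x′∈r′ y∈t y∈r y′∈t y′∈r′
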